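{- Let $\rho(x)$ be a formula and $\varphi$ a sentence in the language of arithmetic such that $\mathsf{PA}+\varphi+\rho(\ulcorner\varphi\urcorner)$ is consistent and $\mathsf{PA}+\varphi+\neg\rho(\ulcorner\varphi\urcorner)$ is $\Pi^0_1$-conservative over $\mathsf{PA}+\varphi$. Then for every $\Pi^0_1$-sentence $\pi$, the sentence $\rho(\ulcorner\varphi\urcorner)\leftrightarrow\pi$ is consistent with $\mathsf{PA}+\varphi$.
   Context: A theory $V+\theta$ is $\Pi^0_1$-conservative over $V$ if every $\Pi^0_1$-sentence provable in $V+\theta$ is provable in $V$. $\ulcorner\varphi\urcorner$ is the numeral of the Gödel number of $\varphi$. -}

module Defs where

open import Data.Nat using (ℕ; zero; suc; _+_; _<_; _<ᵇ_; _≡ᵇ_; pred)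
open import Data.Bool using (if_then_else_)
open import Data.Product using (_×_)
open import Data.Sum using (_⊎_)
open import Data.Unit using (⊤)
open import Relation.Binary.PropositionalEquality using (_≡_)
open import Relation.Nullary using (¬_)

data Term : Set where
  var  : ℕ → Term
  zero' : Term
  suc' : Term → Term
  _+'_ : Term → Term → Term
  _*'_ : Term → Term → Term

infix 6 _+'_
infix 7 _*'_
infix 4 _≐_ _<'_
infixr 2 _⇒_
infixr 3 _∧'_
infix 1 _⇔_
infixl 8 _[_]

data Formula : Set where
  ⊥'   : Formula
  _≐_  : Term → Term → Formula
  _<'_ : Term → Term → Formula
  _⇒_  : Formula → Formula → Formula
  ∀'   : Formula → Formula          -- binds variable 0

¬' : Formula → Formula
¬' φ = φ ⇒ ⊥'

_∧'_ : Formula → Formula → Formula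
φ ∧' ψ = ¬' (φ ⇒ ¬' ψ)

_⇔_ : Formula → Formula → Formula
φ ⇔ ψ = (φ ⇒ ψ) ∧' (ψ ⇒ φ)

∃' : Formula → Formula
∃' φ = ¬' (∀' (¬' φ))

shiftT : ℕ → Term → Term
shiftT c (var i) = if i <ᵇ c then var i else var (suc i)
shiftT c zero' = zero'
shiftT c (suc' t) = suc' (shiftT c t)
shiftT c (s +' t) = shiftT c s +' shiftT c t
shiftT c (s *' t) = shiftT c s *' shiftT c t

shiftF : ℕ → Formula → Formula
shiftF c ⊥' = ⊥'
shiftF c (s ≐ t) = shiftT c s ≐ shiftT c t
shiftF c (s <' t) = shiftT c s <' shiftT c t
shiftF c (φ ⇒ ψ) = shiftF c φ ⇒ shiftF c ψ
shiftF c (∀' φ) = ∀' (shiftF (suc c) φ)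

substT : ℕ → Term → Term → Term
substT k s (var i) =
  if i <ᵇ k then var i else (if i ≡ᵇ k then s else var (pred i))
substT k s zero' = zero'
substT k s (suc' t) = suc' (substT k s t)
substT k s (t +' u) = substT k s t +' substT k s u
substT k s (t *' u) = substT k s t *' substT k s u

substF : ℕ → Term → Formula → Formula
substF k s ⊥' = ⊥'
substF k s (t ≐ u) = substT k s t ≐ substT k s u
substF k s (t <' u) = substT k s t <' substT k s u
substF k s (φ ⇒ ψ) = substF k s φ ⇒ substF k s ψ
substF k s (∀' φ) = ∀' (substF (suc k) (shiftT 0 s) φ)

_[_] : Formula → Term → Formula
φ [ t ] = substF 0 t φ

ClosedAtT : ℕ → Term → Set
ClosedAtT n (var i) = i < n
ClosedAtT n zero' = ⊤
ClosedAtT n (suc' t) = ClosedAtT n t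
ClosedAtT n (s +' t) = ClosedAtT n s × ClosedAtT n t
ClosedAtT n (s *' t) = ClosedAtT n s × ClosedAtT n t

ClosedAt : ℕ → Formula → Set
ClosedAt n ⊥' = ⊤
ClosedAt n (s ≐ t) = ClosedAtT n s × ClosedAtT n t
ClosedAt n (s <' t) = ClosedAtT n s × ClosedAtT n t
ClosedAt n (φ ⇒ ψ) = ClosedAt n φ × ClosedAt n ψ
ClosedAt n (∀' φ) = ClosedAt (suc n) φ

Sentence : Formula → Set
Sentence = ClosedAt 0

num : ℕ → Term
num zero = zero'
num (suc n) = suc' (num n)

tri : ℕ → ℕ
tri zero = zero
tri (suc n) = suc n + tri n

-- Cantor pairing
⟪_,_⟫ : ℕ → ℕ → ℕ
⟪ a , b ⟫ = tri (a + b) + b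

codeT : Term → ℕ
codeT (var i) = ⟪ 0 , i ⟫
codeT zero' = ⟪ 1 , 0 ⟫
codeT (suc' t) = ⟪ 2 , codeT t ⟫
codeT (s +' t) = ⟪ 3 , ⟪ codeT s , codeT t ⟫ ⟫
codeT (s *' t) = ⟪ 4 , ⟪ codeT s , codeT t ⟫ ⟫

codeF : Formula → ℕ
codeF ⊥' = ⟪ 0 , 0 ⟫
codeF (s ≐ t) = ⟪ 1 , ⟪ codeT s , codeT t ⟫ ⟫
codeF (s <' t) = ⟪ 2 , ⟪ codeT s , codeT t ⟫ ⟫
codeF (φ ⇒ ψ) = ⟪ 3 , ⟪ codeF φ , codeF ψ ⟫ ⟫
codeF (∀' φ) = ⟪ 4 , codeF φ ⟫

⌜_⌝ : Formula → Term
⌜ φ ⌝ = num (codeF φ)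

-- Logical calculus (Enderton style: generalisations of axioms, rule MP)

data LogAx : Formula → Set where
  ax-K    : ∀ φ ψ → LogAx (φ ⇒ ψ ⇒ φ)
  ax-S    : ∀ φ ψ χ → LogAx ((φ ⇒ ψ ⇒ χ) ⇒ (φ ⇒ ψ) ⇒ φ ⇒ χ)
  ax-C    : ∀ φ ψ → LogAx ((¬' φ ⇒ ¬' ψ) ⇒ ψ ⇒ φ)
  ax-inst : ∀ φ t → LogAx (∀' φ ⇒ φ [ t ])
  ax-dist : ∀ φ ψ → LogAx (∀' (φ ⇒ ψ) ⇒ ∀' φ ⇒ ∀' ψ)
  ax-vac  : ∀ φ → LogAx (φ ⇒ ∀' (shiftF 0 φ))
  ax-refl : ∀ t → LogAx (t ≐ t)
  ax-eq   : ∀ s t φ → LogAx (s ≐ t ⇒ φ [ s ] ⇒ φ [ t ])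
  ax-gen  : ∀ {φ} → LogAx φ → LogAx (∀' φ)

Theory : Set₁
Theory = Formula → Set

infix 1 _⊢_
data _⊢_ (T : Theory) : Formula → Set where
  ax  : ∀ {φ} → T φ → T ⊢ φ
  log : ∀ {φ} → LogAx φ → T ⊢ φ
  mp  : ∀ {φ ψ} → T ⊢ φ ⇒ ψ → T ⊢ φ → T ⊢ ψ

_⊕_ : Theory → Formula → Theory
(T ⊕ φ) ψ = T ψ ⊎ ψ ≡ φ

Consistent : Theory → Set
Consistent T = ¬ (T ⊢ ⊥')

∀ⁿ : ℕ → Formula → Formula
∀ⁿ zero φ = φ
∀ⁿ (suc n) φ = ∀' (∀ⁿ n φ)

-- induction instance for ψ (variable 0 is the induction variable,
-- the others are parameters)
indScheme : Formula → Formula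
indScheme ψ =
  (ψ [ zero' ] ∧' ∀' (ψ ⇒ (shiftF 1 ψ) [ suc' (var 0) ])) ⇒ ∀' ψ

x0 x1 x2 : Term
x0 = var 0
x1 = var 1
x2 = var 2

data PA : Formula → Set where
  Q1 : PA (∀' (¬' (suc' x0 ≐ zero')))
  Q2 : PA (∀' (∀' (suc' x1 ≐ suc' x0 ⇒ x1 ≐ x0)))
  Q3 : PA (∀' (¬' (x0 ≐ zero') ⇒ ∃' (x1 ≐ suc' x0)))
  Q4 : PA (∀' (x0 +' zero' ≐ x0))
  Q5 : PA (∀' (∀' (x1 +' suc' x0 ≐ suc' (x1 +' x0))))
  Q6 : PA (∀' (x0 *' zero' ≐ zero'))
  Q7 : PA (∀' (∀' (x1 *' suc' x0 ≐ x1 *' x0 +' x1)))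
  Q8 : PA (∀' (∀' (x1 <' x0 ⇔ ∃' (x2 +' suc' x0 ≐ x1))))
  -- universal closures of induction instances
  IND : ∀ n ψ → Sentence (∀ⁿ n (indScheme ψ)) → PA (∀ⁿ n (indScheme ψ))

-- Δ0: atomic formulas, ⊥, →, and bounded universal quantification
-- ∀x<t.φ  (t not containing x); ∧,∨,¬,bounded ∃ are abbreviations.
data Δ0 : Formula → Set where
  δ-⊥  : Δ0 ⊥'
  δ-eq : ∀ s t → Δ0 (s ≐ t)
  δ-lt : ∀ s t → Δ0 (s <' t)
  δ-⇒  : ∀ {φ ψ} → Δ0 φ → Δ0 ψ → Δ0 (φ ⇒ ψ)
  δ-∀< : ∀ t {φ} → Δ0 φ → Δ0 (∀' (var 0 <' shiftT 0 t ⇒ φ))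

data Π1 : Formula → Set where
  π-δ : ∀ {φ} → Δ0 φ → Π1 φ
  π-∀ : ∀ {φ} → Π1 φ → Π1 (∀' φ)

Π1Conservative : Theory → Theory → Set
Π1Conservative U T = ∀ π → Sentence π → Π1 π → U ⊢ π → T ⊢ π

{-# OPTIONS --safe #-}
module Submission where

-- Write T = PA + φ and R = ρ(⌜φ⌝). If T refuted
-- R ↔ π, then T + ¬R would prove π (¬R together with ¬π already gives
-- R ↔ π), so by Π⁰₁-conservativity T itself would prove π. But then
-- T + R proves R ↔ π as well, making T + R inconsistent.

open import Defs
open import Data.Sum using (inj₁; inj₂)
open import Relation.Binary.PropositionalEquality using (refl)

variable
  T : Theory
  α β : Formula

⊢⇒-refl : T ⊢ α ⇒ α
⊢⇒-refl {α = α} =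
  mp (mp (log (ax-S α (α ⇒ α) α)) (log (ax-K α (α ⇒ α)))) (log (ax-K α α))

⊢⇒-const : T ⊢ α → T ⊢ β ⇒ α
⊢⇒-const {α = α} {β = β} = mp (log (ax-K α β))

assumption : (T ⊕ α) ⊢ α
assumption = ax (inj₂ refl)

weaken : T ⊢ β → (T ⊕ α) ⊢ β
weaken (ax T⊢β)  = ax (inj₁ T⊢β)
weaken (log l)   = log l
weaken (mp d e)  = mp (weaken d) (weaken e)

deduction : (T ⊕ α) ⊢ β → T ⊢ α ⇒ β
deduction (ax (inj₁ T⊢β)) = ⊢⇒-const (ax T⊢β)
deduction (ax (inj₂ refl)) = ⊢⇒-refl
deduction (log l)          = ⊢⇒-const (log l)
deduction (mp d e)         = mp (mp (log (ax-S _ _ _)) (deduction d)) (deduction e)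

-- Contraposition ax-C with ψ = ¬' ⊥', whose premise ψ is provable outright.
by-contradiction : (T ⊕ ¬' α) ⊢ ⊥' → T ⊢ α
by-contradiction {α = α} ¬α⊢⊥ =
  mp (mp (log (ax-C α (¬' ⊥'))) (deduction (⊢⇒-const ¬α⊢⊥))) ⊢⇒-refl

explosion : T ⊢ ⊥' → T ⊢ α
explosion T⊢⊥ = by-contradiction (weaken T⊢⊥)

¬⇒-exfalso : T ⊢ ¬' α → T ⊢ α ⇒ β
¬⇒-exfalso T⊢¬α = deduction (explosion (mp (weaken T⊢¬α) assumption))

∧-intro : T ⊢ α → T ⊢ β → T ⊢ α ∧' β
∧-intro T⊢α T⊢β = deduction (mp (mp assumption (weaken T⊢α)) (weaken T⊢β))

⇔-intro : T ⊢ α → T ⊢ β → T ⊢ (α ⇔ β)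
⇔-intro T⊢α T⊢β = ∧-intro (⊢⇒-const T⊢β) (⊢⇒-const T⊢α)

¬⇔-elim : T ⊢ ¬' (α ⇔ β) → (T ⊕ ¬' α) ⊢ β
¬⇔-elim {T = T} {α = α} {β = β} T⊢¬⇔ =
  by-contradiction (mp (weaken (weaken T⊢¬⇔)) α⇔β)
  where
  α⇔β : ((T ⊕ ¬' α) ⊕ ¬' β) ⊢ (α ⇔ β)
  α⇔β = ∧-intro (¬⇒-exfalso (weaken assumption)) (¬⇒-exfalso assumption)

mainTheorem4 : (ρ φ : Formula) → ClosedAt 1 ρ → Sentence φ →
    Consistent ((PA ⊕ φ) ⊕ (ρ [ ⌜ φ ⌝ ])) →
    Π1Conservative ((PA ⊕ φ) ⊕ ¬' (ρ [ ⌜ φ ⌝ ])) (PA ⊕ φ) →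
    (π : Formula) → Sentence π → Π1 π →
    Consistent ((PA ⊕ φ) ⊕ ((ρ [ ⌜ φ ⌝ ]) ⇔ π))
mainTheorem4 ρ φ _ _ consistent-ρ conservative π sentence-π Π1-π ⇔⊢⊥ =
  consistent-ρ (mp (weaken refutes-⇔) (⇔-intro assumption (weaken proves-π)))
  where
  refutes-⇔ : PA ⊕ φ ⊢ ¬' ((ρ [ ⌜ φ ⌝ ]) ⇔ π)
  refutes-⇔ = deduction ⇔⊢⊥

  proves-π : PA ⊕ φ ⊢ π
  proves-π = conservative π sentence-π Π1-π (¬⇔-elim refutes-⇔)
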